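{- Let $g\ge3$ and $2\le k<g$ be integers such that the $(g,k)$ Young graph exists. If the Young graph contains an edge $[r',r]\xrightarrow{(a,b)}[r,r']$ with $r'\ne r$, or if some node $[r,r]$ carries a loop with label $(a,b)$, then $a=b$.
   Context: Young graph. The directed edge-labelled graph $H(g,k)$ is defined as follows. Its possible nodes are a distinguished starting node, written $[[0,0]]$, and ordered pairs $[s,r]$ of integers with $0\le s,r\le k-1$ (the pair $[0,0]$ is a node distinct from the starting node). For a node $[s,r]$ (the starting node being treated as $s=r=0$) and each pair of digits $(c,a)$, $0\le a,c\le g-1$, with $ka+r\equiv c \pmod g$ and $0\le a+sg-kc\le k-1$, there is a directed edge labelled $(c,a)$ from $[s,r]$ to the node $[\,a+sg-kc,\ (ka+r-c)/g\,]$; for edges leaving the starting node one additionally requires $a\ne0$ and $c\ne0$. $H(g,k)$ consists of the starting node, the nodes reachable from it by directed paths, and all edges leaving these nodes. A non-starting node of the form $[r,r]$ ($r\ge0$, including $[0,0]$) is an even pivot node; a non-starting node is an odd pivot node if it is of the form $[r,r]$ and carries a loop, or is of the form $[r',r]$ with $r'\ne r$ and has an edge to $[r,r']$. The $(g,k)$ Young graph exists if $H(g,k)$ contains a node $[r,r]$ with $r\ne0$ or an edge $[r',r]\to[r,r']$ with $r'\ne r$; it is then obtained from $H(g,k)$ by deleting every node from which no pivot node can be reached by a directed path, together with all edges incident to such nodes. Nodes in the statement are non-starting nodes. -}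

module Defs where

open import Data.Nat using (ℕ; zero; suc; _+_; _*_; _<_; _≤_)
open import Data.Product using (Σ; ∃; ∃-syntax; _×_; _,_)
open import Data.Sum using (_⊎_)
open import Relation.Binary.PropositionalEquality using (_≡_; _≢_)
open import Relation.Binary.Construct.Closure.ReflexiveTransitive using (Star)

data Node : Set where
  start : Node
  ⟦_,_⟧ : ℕ → ℕ → Node

-- For source [s,r], target [s',r'] with
--   s' = a + s g - k c,  0 ≤ s' ≤ k-1   (encoded: k*c + s' ≡ a + s*g, s' < k)
--   r' = (k a + r - c)/g, where k a + r ≡ c (mod g)
--                                       (encoded: c + r'*g ≡ k*a + r)
-- From the start node (s = r = 0) additionally a ≠ 0 and c ≠ 0.
data Edge (g k : ℕ) : Node → ℕ → ℕ → Node → Set where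
  step : ∀ {s r c a s' r'} → a < g → c < g →
         k * c + s' ≡ a + s * g → s' < k →
         c + r' * g ≡ k * a + r →
         Edge g k ⟦ s , r ⟧ c a ⟦ s' , r' ⟧
  first : ∀ {c a s' r'} → a < g → c < g → a ≢ 0 → c ≢ 0 →
          k * c + s' ≡ a + 0 * g → s' < k →
          c + r' * g ≡ k * a + 0 →
          Edge g k start c a ⟦ s' , r' ⟧

Step : ℕ → ℕ → Node → Node → Set
Step g k u v = ∃[ c ] ∃[ a ] Edge g k u c a v

Path : ℕ → ℕ → Node → Node → Set
Path g k = Star (Step g k)

InH : ℕ → ℕ → Node → Set
InH g k u = Path g k start u

EvenPivot : Node → Set
EvenPivot u = ∃[ r ] (u ≡ ⟦ r , r ⟧)

OddPivot : ℕ → ℕ → Node → Set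
OddPivot g k u =
  (∃[ r ] (u ≡ ⟦ r , r ⟧ × Step g k ⟦ r , r ⟧ ⟦ r , r ⟧))
  ⊎ (∃[ r' ] ∃[ r ] (r' ≢ r × u ≡ ⟦ r' , r ⟧ × Step g k ⟦ r' , r ⟧ ⟦ r , r' ⟧))

Pivot : ℕ → ℕ → Node → Set
Pivot g k u = EvenPivot u ⊎ OddPivot g k u

YoungExists : ℕ → ℕ → Set
YoungExists g k =
  (∃[ r ] (r ≢ 0 × InH g k ⟦ r , r ⟧))
  ⊎ (∃[ r' ] ∃[ r ] (r' ≢ r × InH g k ⟦ r' , r ⟧ × Step g k ⟦ r' , r ⟧ ⟦ r , r' ⟧))

InYoung : ℕ → ℕ → Node → Set
InYoung g k u = InH g k u × ∃[ v ] (Path g k u v × Pivot g k v)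

YoungEdge : ℕ → ℕ → Node → ℕ → ℕ → Node → Set
YoungEdge g k u c a v = InYoung g k u × InYoung g k v × Edge g k u c a v

module Submission where

open import Defs
open import Data.Nat using (ℕ; _≤_; _<_; _+_; _*_; suc)
open import Data.Nat.Properties using (+-cancelʳ-≡; *-cancelˡ-≡)
open import Data.Nat.Tactic.RingSolver using (solve)
open import Data.List using ([]; _∷_)
open import Data.Product using (_×_; _,_)
open import Relation.Binary.PropositionalEquality using (_≡_; _≢_; cong₂; module ≡-Reasoning)

digits-equal : ∀ k c a x y → k * c + x ≡ a + y → c + y ≡ k * a + x → c ≡ a
digits-equal k c a x y e₁ e₂ =
  *-cancelˡ-≡ c a (suc k) (+-cancelʳ-≡ (x + y) (suc k * c) (suc k * a) sum)
  where
  open ≡-Reasoning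
  sum : suc k * c + (x + y) ≡ suc k * a + (x + y)
  sum = begin
    suc k * c + (x + y)          ≡⟨ solve (k ∷ c ∷ x ∷ y ∷ []) ⟩
    (k * c + x) + (c + y)        ≡⟨ cong₂ _+_ e₁ e₂ ⟩
    (a + y) + (k * a + x)        ≡⟨ solve (k ∷ a ∷ x ∷ y ∷ []) ⟩
    suc k * a + (x + y)          ∎

edge-to-swap⇒equal-digits : ∀ {g k s r c a} → Edge g k ⟦ s , r ⟧ c a ⟦ r , s ⟧ → c ≡ a
edge-to-swap⇒equal-digits {g} {k} {s} {r} {c} {a} (step _ _ e₁ _ e₂) =
  digits-equal k c a r (s * g) e₁ e₂

mainTheorem6 : (g k : ℕ) → 3 ≤ g → 2 ≤ k → k < g → YoungExists g k →
    ((r' r a b : ℕ) → r' ≢ r → YoungEdge g k ⟦ r' , r ⟧ a b ⟦ r , r' ⟧ → a ≡ b)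
    × ((r a b : ℕ) → YoungEdge g k ⟦ r , r ⟧ a b ⟦ r , r ⟧ → a ≡ b)
mainTheorem6 g k _ _ _ _ =
    (λ _ _ _ _ _ (_ , _ , edge) → edge-to-swap⇒equal-digits edge)
  , (λ _ _ _ (_ , _ , loop) → edge-to-swap⇒equal-digits loop)
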